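{- Let $G$ be a matrix over $\mathbb F_2$ with columns $v_1,\dots,v_n$, let $p$ be the maximal multiplicity of a column in $G$, and let $\sigma$ be a positive integer with $\sigma>p$ such that for every $i\in[n]$ there are at least $\sigma$ two-element sets $\{j,k\}\subseteq[n]\setminus\{i\}$ with $v_i+v_j+v_k=0$. Then for each $i\in[n]$ with $v_i\neq 0$ there are at least $\lceil\sigma/p\rceil$ pairwise disjoint two-element sets $\{j,l\}\subseteq[n]$ with $i\notin\{j,l\}$ and $v_i=v_j+v_l$. -}

module Defs where

open import Data.Bool using (Bool; true; false; _xor_)
open import Data.Nat using (ℕ; zero; suc; _+_; _⊔_; _<_)
open import Data.Nat.DivMod using (_/_)
open import Data.Fin using (Fin; toℕ)
import Data.Fin as F
open import Data.Vec using (Vec; zipWith; replicate)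
open import Data.Vec.Properties using (≡-dec)
import Data.Bool.Properties as BP
open import Data.Product using (_×_; _,_; proj₁; proj₂)
open import Relation.Nullary using (Dec; does; ¬_)
open import Relation.Binary.PropositionalEquality using (_≡_; _≢_)

F2Vec : ℕ → Set
F2Vec m = Vec Bool m

_⊕_ : ∀ {m} → F2Vec m → F2Vec m → F2Vec m
_⊕_ = zipWith _xor_

infixl 6 _⊕_

𝟎 : ∀ {m} → F2Vec m
𝟎 = replicate _ false

_≟v_ : ∀ {m} (x y : F2Vec m) → Dec (x ≡ y)
_≟v_ = ≡-dec BP._≟_

-- A matrix over F₂ with m rows and n columns, given by its columns v₁..vₙ.
Matrix : ℕ → ℕ → Set
Matrix m n = Fin n → F2Vec m

count : ∀ {n} → (Fin n → Bool) → ℕ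
count {zero}  P = 0
count {suc n} P = (if P F.zero then 1 else 0) + count (λ i → P (F.suc i))
  where
  if_then_else_ : Bool → ℕ → ℕ → ℕ
  if true  then a else b = a
  if false then a else b = b

sumF : ∀ {n} → (Fin n → ℕ) → ℕ
sumF {zero}  f = 0
sumF {suc n} f = f F.zero + sumF (λ i → f (F.suc i))

maxF : ∀ {n} → (Fin n → ℕ) → ℕ
maxF {zero}  f = 0
maxF {suc n} f = f F.zero ⊔ maxF (λ i → f (F.suc i))

mult : ∀ {m n} → Matrix m n → Fin n → ℕ
mult v i = count (λ j → does (v j ≟v v i))

maxMult : ∀ {m n} → Matrix m n → ℕ
maxMult v = maxF (mult v)

-- Number of two-element sets {j,k} ⊆ [n] ∖ {i} with v i + v j + v k = 0.
-- A two-element set is counted once as the ordered pair (j,k) with j < k.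
tripleCount : ∀ {m n} → Matrix m n → Fin n → ℕ
tripleCount v i =
  sumF (λ j → count (λ k →
    does (toℕ j Data.Nat.<? toℕ k) ∧ (not (does (j F.≟ i)) ∧
    (not (does (k F.≟ i)) ∧ does ((v i ⊕ v j ⊕ v k) ≟v 𝟎)))))
  where open Data.Bool using (_∧_; not)

-- Ceiling of σ / p (with the unused convention ⌈σ/0⌉ = 0).
⌈_/_⌉ : ℕ → ℕ → ℕ
⌈ σ / zero  ⌉ = 0
⌈ σ / suc q ⌉ = (σ + q) / suc q

Disjoint₂ : ∀ {n} → Fin n × Fin n → Fin n × Fin n → Set
Disjoint₂ (j , l) (j' , l') = j ≢ j' × j ≢ l' × l ≢ j' × l ≢ l'

-- Write u = vᵢ and group the columns other than i into classes of equal columns. A pair {j, k}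
-- counted by tripleCount joins the class of some w to the class of u + w, and these two classes
-- differ since u ≠ 0. From each such pair of classes choose the smaller one, ties broken by a
-- coordinate where u is 1. Every counted pair then has exactly one endpoint in a chosen class, and
-- a chosen column j lies in at most p counted pairs (its partners are the columns equal to u + vⱼ),
-- so σ ≤ k p for the number k of chosen columns. Mapping each chosen class injectively into its
-- partner class pairs every chosen column j with some l such that vⱼ + vₗ = u, and these k pairs
-- are disjoint because no column is both chosen and the image of a chosen one.
module Submission where

open import Defs
open import Data.Nat.Properties
  using (+-*-semiring; module ≤-Reasoning; ≤-refl; ≤-trans; <-asym; <ᵇ⇒<; m≤n⇒m≤1+n;
         m≤m⊔n; m≤n⊔m; +-comm; +-identityʳ; *-identityˡ; *-distribˡ-+; *-distribʳ-+;
         +-mono-≤; +-monoˡ-≤; *-monoˡ-≤; *-monoʳ-≤)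
open import Algebra.Properties.Semiring.Sum +-*-semiring
  using (sum-syntax; sum-cong-≗; ∑-comm; ∑-distrib-+; *-distribˡ-sum; *-distribʳ-sum)
open import Data.Bool using (Bool; true; false; T; not; _∧_; _∨_; _xor_; if_then_else_)
open import Data.Bool.Properties
  using (∧-assoc; ∧-comm; T-≡; T-∧; T-∨; xor-comm; xor-assoc; xor-same; xor-identityˡ)
open import Data.Empty using (⊥-elim)
open import Data.Fin using (Fin; zero; suc; toℕ; inject≤; _≟_)
open import Data.Fin.Properties using (suc-injective; toℕ-injective; toℕ-inject≤)
open import Data.Nat using (ℕ; zero; suc; _+_; _*_; _≤_; _<_; _<ᵇ_; s≤s⁻¹; z≤n; s≤s)
open import Data.Nat.DivMod using (_/_; m<n*o⇒m/o<n)
open import Data.Product using (Σ; ∃; _×_; _,_; proj₁; proj₂)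
open import Data.Sum using (_⊎_; inj₁; inj₂)
import Data.Sum as Sum
open import Data.Vec using ([]; _∷_; lookup)
open import Data.Vec.Properties using (lookup-zipWith; zipWith-comm; zipWith-assoc; zipWith-identityˡ)
open import Function using (_∘_)
open import Function.Bundles using (Equivalence)
open import Relation.Nullary using (¬_; Dec; does; yes; no)
open import Relation.Binary.PropositionalEquality

open Equivalence using (to; from)

⊕-comm : ∀ {m} (x y : F2Vec m) → x ⊕ y ≡ y ⊕ x
⊕-comm = zipWith-comm xor-comm

⊕-assoc : ∀ {m} (x y z : F2Vec m) → x ⊕ y ⊕ z ≡ x ⊕ (y ⊕ z)
⊕-assoc = zipWith-assoc xor-assoc

⊕-identityˡ : ∀ {m} (x : F2Vec m) → 𝟎 ⊕ x ≡ x
⊕-identityˡ = zipWith-identityˡ xor-identityˡ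

x⊕x≡𝟎 : ∀ {m} (x : F2Vec m) → x ⊕ x ≡ 𝟎
x⊕x≡𝟎 []      = refl
x⊕x≡𝟎 (a ∷ x) = cong₂ _∷_ (xor-same a) (x⊕x≡𝟎 x)

x⊕[x⊕y]≡y : ∀ {m} (x y : F2Vec m) → x ⊕ (x ⊕ y) ≡ y
x⊕[x⊕y]≡y x y = begin
  x ⊕ (x ⊕ y) ≡⟨ ⊕-assoc x x y ⟨
  x ⊕ x ⊕ y   ≡⟨ cong (_⊕ y) (x⊕x≡𝟎 x) ⟩
  𝟎 ⊕ y       ≡⟨ ⊕-identityˡ y ⟩
  y           ∎
  where open ≡-Reasoning

⊕-cancelˡ-≡ : ∀ {m} (x : F2Vec m) {y z} → x ⊕ y ≡ x ⊕ z → y ≡ z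
⊕-cancelˡ-≡ x {y} {z} eq = trans (sym (x⊕[x⊕y]≡y x y)) (trans (cong (x ⊕_) eq) (x⊕[x⊕y]≡y x z))

x⊕y≡𝟎⇒x≡y : ∀ {m} {x y : F2Vec m} → x ⊕ y ≡ 𝟎 → x ≡ y
x⊕y≡𝟎⇒x≡y {x = x} eq = sym (⊕-cancelˡ-≡ x (trans eq (sym (x⊕x≡𝟎 x))))

x≡y⊕[x⊕y] : ∀ {m} (x y : F2Vec m) → x ≡ y ⊕ (x ⊕ y)
x≡y⊕[x⊕y] x y = sym (trans (cong (y ⊕_) (⊕-comm x y)) (x⊕[x⊕y]≡y y x))

x⊕y⊕z≡x⊕z⊕y : ∀ {m} (x y z : F2Vec m) → x ⊕ y ⊕ z ≡ x ⊕ z ⊕ y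
x⊕y⊕z≡x⊕z⊕y x y z = begin
  x ⊕ y ⊕ z   ≡⟨ ⊕-assoc x y z ⟩
  x ⊕ (y ⊕ z) ≡⟨ cong (x ⊕_) (⊕-comm y z) ⟩
  x ⊕ (z ⊕ y) ≡⟨ ⊕-assoc x z y ⟨
  x ⊕ z ⊕ y   ∎
  where open ≡-Reasoning

≢𝟎⇒∃lookup≡true : ∀ {m} {x : F2Vec m} → x ≢ 𝟎 → ∃ λ r → lookup x r ≡ true
≢𝟎⇒∃lookup≡true {x = []}        x≢𝟎 = ⊥-elim (x≢𝟎 refl)
≢𝟎⇒∃lookup≡true {x = true ∷ x}  x≢𝟎 = zero , refl
≢𝟎⇒∃lookup≡true {x = false ∷ x} x≢𝟎 =
  let r , x[r] = ≢𝟎⇒∃lookup≡true (x≢𝟎 ∘ cong (false ∷_)) in suc r , x[r]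

does⇒ : ∀ {A : Set} (a? : Dec A) → T (does a?) → A
does⇒ (yes a) _ = a

⇒does : ∀ {A : Set} (a? : Dec A) → A → T (does a?)
⇒does (yes _)  _ = _
⇒does (no ¬a)  a = ¬a a

not-does⇒¬ : ∀ {A : Set} (a? : Dec A) → T (not (does a?)) → ¬ A
not-does⇒¬ (no ¬a) _ = ¬a

𝟙 : Bool → ℕ
𝟙 b = if b then 1 else 0

𝟙-∧ : ∀ b c → 𝟙 (b ∧ c) ≡ 𝟙 b * 𝟙 c
𝟙-∧ true  c = sym (+-identityʳ (𝟙 c))
𝟙-∧ false c = refl

sumF≡∑ : ∀ {n} (f : Fin n → ℕ) → sumF f ≡ ∑[ j < n ] f j
sumF≡∑ {zero}  f = refl
sumF≡∑ {suc n} f = cong (f zero +_) (sumF≡∑ (f ∘ suc))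

count≡∑𝟙 : ∀ {n} (P : Fin n → Bool) → count P ≡ ∑[ j < n ] 𝟙 (P j)
count≡∑𝟙 {zero}  P = refl
count≡∑𝟙 {suc n} P with P zero
... | true  = cong suc (count≡∑𝟙 (P ∘ suc))
... | false = count≡∑𝟙 (P ∘ suc)

∑-mono-≤ : ∀ {n} {f g : Fin n → ℕ} → (∀ j → f j ≤ g j) → ∑[ j < n ] f j ≤ ∑[ j < n ] g j
∑-mono-≤ {zero}  f≤g = z≤n
∑-mono-≤ {suc n} f≤g = +-mono-≤ (f≤g zero) (∑-mono-≤ (f≤g ∘ suc))

f≤maxF : ∀ {n} (f : Fin n → ℕ) j → f j ≤ maxF f
f≤maxF f zero    = m≤m⊔n _ _
f≤maxF f (suc j) = ≤-trans (f≤maxF (f ∘ suc) j) (m≤n⊔m _ _)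

count-mono : ∀ {n} {P Q : Fin n → Bool} → (∀ j → T (P j) → T (Q j)) → count P ≤ count Q
count-mono {zero}          P⇒Q = z≤n
count-mono {suc n} {P} {Q} P⇒Q with P zero | Q zero | P⇒Q zero
... | true  | true  | _  = s≤s (count-mono (P⇒Q ∘ suc))
... | true  | false | P₀⇒Q₀ = ⊥-elim (P₀⇒Q₀ _)
... | false | true  | _  = m≤n⇒m≤1+n (count-mono (P⇒Q ∘ suc))
... | false | false | _  = count-mono (P⇒Q ∘ suc)

infix 7 _≺_

_≺_ : ∀ {n} → Fin n → Fin n → Bool
j ≺ k = toℕ j <ᵇ toℕ k

≺-asym : ∀ {n} (j k : Fin n) → 𝟙 (j ≺ k) + 𝟙 (k ≺ j) ≤ 1
≺-asym j k with j ≺ k in j≺k | k ≺ j in k≺j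
... | true  | true  =
  ⊥-elim (<-asym (<ᵇ⇒< (toℕ j) (toℕ k) (from T-≡ j≺k)) (<ᵇ⇒< (toℕ k) (toℕ j) (from T-≡ k≺j)))
... | true  | false = ≤-refl
... | false | true  = ≤-refl
... | false | false = z≤n

∑-upperTriangle≤ : ∀ {n} (g : Fin n → Fin n → ℕ) →
  ∑[ j < n ] ∑[ k < n ] (𝟙 (j ≺ k) * (g j k + g k j)) ≤ ∑[ j < n ] ∑[ k < n ] g j k
∑-upperTriangle≤ {n} g = begin
  ∑[ j < n ] ∑[ k < n ] (𝟙 (j ≺ k) * (g j k + g k j))
    ≡⟨ ∑²-cong (λ j k → *-distribˡ-+ (𝟙 (j ≺ k)) (g j k) (g k j)) ⟩
  ∑[ j < n ] ∑[ k < n ] (𝟙 (j ≺ k) * g j k + 𝟙 (j ≺ k) * g k j)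
    ≡⟨ ∑²-distrib-+ _ _ ⟩
  ∑[ j < n ] ∑[ k < n ] (𝟙 (j ≺ k) * g j k) + ∑[ j < n ] ∑[ k < n ] (𝟙 (j ≺ k) * g k j)
    ≡⟨ cong (∑[ j < n ] ∑[ k < n ] (𝟙 (j ≺ k) * g j k) +_) (∑-comm (λ j k → 𝟙 (j ≺ k) * g k j)) ⟩
  ∑[ j < n ] ∑[ k < n ] (𝟙 (j ≺ k) * g j k) + ∑[ j < n ] ∑[ k < n ] (𝟙 (k ≺ j) * g j k)
    ≡⟨ ∑²-distrib-+ _ _ ⟨
  ∑[ j < n ] ∑[ k < n ] (𝟙 (j ≺ k) * g j k + 𝟙 (k ≺ j) * g j k)
    ≡⟨ ∑²-cong (λ j k → *-distribʳ-+ (g j k) (𝟙 (j ≺ k)) (𝟙 (k ≺ j))) ⟨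
  ∑[ j < n ] ∑[ k < n ] ((𝟙 (j ≺ k) + 𝟙 (k ≺ j)) * g j k)
    ≤⟨ ∑-mono-≤ (λ j → ∑-mono-≤ (λ k → *-monoˡ-≤ (g j k) (≺-asym j k))) ⟩
  ∑[ j < n ] ∑[ k < n ] (1 * g j k)
    ≡⟨ ∑²-cong (λ j k → *-identityˡ (g j k)) ⟩
  ∑[ j < n ] ∑[ k < n ] g j k ∎
  where
  open ≤-Reasoning

  ∑²-cong : {f h : Fin n → Fin n → ℕ} → (∀ j k → f j k ≡ h j k) →
    ∑[ j < n ] ∑[ k < n ] f j k ≡ ∑[ j < n ] ∑[ k < n ] h j k
  ∑²-cong f≡h = sum-cong-≗ (λ j → sum-cong-≗ (f≡h j))

  ∑²-distrib-+ : (f h : Fin n → Fin n → ℕ) →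
    ∑[ j < n ] ∑[ k < n ] (f j k + h j k) ≡ ∑[ j < n ] ∑[ k < n ] f j k + ∑[ j < n ] ∑[ k < n ] h j k
  ∑²-distrib-+ f h = trans (sum-cong-≗ (λ j → ∑-distrib-+ (f j) (h j)))
                           (∑-distrib-+ (λ j → ∑[ k < n ] f j k) (λ j → ∑[ k < n ] h j k))

pairCount : ∀ {n} → (Fin n → Fin n → Bool) → ℕ
pairCount e = sumF (λ j → count (λ k → j ≺ k ∧ e j k))

pairCount≤count*degree : ∀ {n} (e : Fin n → Fin n → Bool) (C : Fin n → Bool) (d : ℕ) →
  (∀ j k → e j k ≡ e k j) → (∀ j k → T (e j k) → T (C j ∨ C k)) →
  (∀ j → T (C j) → count (e j) ≤ d) → pairCount e ≤ count C * d
pairCount≤count*degree {n} e C d e-sym cover degree≤d = begin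
  pairCount e
    ≡⟨ trans (sumF≡∑ (λ j → count (λ k → j ≺ k ∧ e j k)))
         (sum-cong-≗ (λ j → trans (count≡∑𝟙 (λ k → j ≺ k ∧ e j k))
                                  (sum-cong-≗ (λ k → 𝟙-∧ (j ≺ k) (e j k))))) ⟩
  ∑[ j < n ] ∑[ k < n ] (𝟙 (j ≺ k) * 𝟙 (e j k))
    ≤⟨ ∑-mono-≤ (λ j → ∑-mono-≤ (λ k → *-monoʳ-≤ (𝟙 (j ≺ k)) (edge-covered j k))) ⟩
  ∑[ j < n ] ∑[ k < n ] (𝟙 (j ≺ k) * (f j k + f k j))
    ≤⟨ ∑-upperTriangle≤ f ⟩
  ∑[ j < n ] ∑[ k < n ] (𝟙 (C j) * 𝟙 (e j k))
    ≡⟨ sum-cong-≗ (λ j → trans (cong (𝟙 (C j) *_) (count≡∑𝟙 (e j)))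
                               (*-distribˡ-sum (𝟙 (C j)) (𝟙 ∘ e j))) ⟨
  ∑[ j < n ] (𝟙 (C j) * count (e j))
    ≤⟨ ∑-mono-≤ degree≤ ⟩
  ∑[ j < n ] (𝟙 (C j) * d)
    ≡⟨ trans (cong (_* d) (count≡∑𝟙 C)) (*-distribʳ-sum d (𝟙 ∘ C)) ⟨
  count C * d ∎
  where
  open ≤-Reasoning

  f : Fin n → Fin n → ℕ
  f j k = 𝟙 (C j) * 𝟙 (e j k)

  edge-covered : ∀ j k → 𝟙 (e j k) ≤ f j k + f k j
  edge-covered j k rewrite e-sym k j with e j k | cover j k
  ... | false | _ = z≤n
  ... | true  | cover-jk with C j | C k | cover-jk _
  ...   | true  | _    | _ = s≤s z≤n
  ...   | false | true | _ = s≤s z≤n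

  degree≤ : ∀ j → 𝟙 (C j) * count (e j) ≤ 𝟙 (C j) * d
  degree≤ j with C j | degree≤d j
  ... | true  | deg = +-monoˡ-≤ 0 (deg _)
  ... | false | _   = z≤n

enum : ∀ {n} (P : Fin n → Bool) → Fin (count P) → Fin n
enum {suc n} P a with P zero
enum {suc n} P zero    | true  = zero
enum {suc n} P (suc a) | true  = suc (enum (P ∘ suc) a)
enum {suc n} P a       | false = suc (enum (P ∘ suc) a)

enum-sound : ∀ {n} (P : Fin n → Bool) a → T (P (enum P a))
enum-sound {suc n} P a with P zero in P₀
enum-sound {suc n} P zero    | true rewrite P₀ = _
enum-sound {suc n} P (suc a) | true  = enum-sound (P ∘ suc) a
enum-sound {suc n} P a       | false = enum-sound (P ∘ suc) a

enum-injective : ∀ {n} (P : Fin n → Bool) {a b} → enum P a ≡ enum P b → a ≡ b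
enum-injective {suc n} P {a} {b} eq with P zero
enum-injective {suc n} P {zero}  {zero}  eq | true  = refl
enum-injective {suc n} P {suc a} {suc b} eq | true  = cong suc (enum-injective (P ∘ suc) (suc-injective eq))
enum-injective {suc n} P {a}     {b}     eq | false = enum-injective (P ∘ suc) (suc-injective eq)

rank : ∀ {n} (P : Fin n → Bool) j → T (P j) → Fin (count P)
rank {suc n} P zero    p with P zero
... | true = zero
rank {suc n} P (suc j) p with P zero
... | true  = suc (rank (P ∘ suc) j p)
... | false = rank (P ∘ suc) j p

enum-rank : ∀ {n} (P : Fin n → Bool) j (p : T (P j)) → enum P (rank P j p) ≡ j
enum-rank {suc n} P zero    p with P zero
... | true = refl
enum-rank {suc n} P (suc j) p with P zero
... | true  = cong suc (enum-rank (P ∘ suc) j p)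
... | false = cong suc (enum-rank (P ∘ suc) j p)

count≡0⊎∃ : ∀ {n} (P : Fin n → Bool) → count P ≡ 0 ⊎ ∃ (T ∘ P)
count≡0⊎∃ P with count P | enum P | enum-sound P
... | zero  | _     | _     = inj₁ refl
... | suc _ | enumP | sound = inj₂ (enumP zero , sound zero)

embed : ∀ {n} (P Q : Fin n → Bool) → .(count P ≤ count Q) → ∀ j → T (P j) → Fin n
embed P Q P≤Q j p = enum Q (inject≤ (rank P j p) P≤Q)

embed-sound : ∀ {n} (P Q : Fin n → Bool) .(P≤Q : count P ≤ count Q) j (p : T (P j)) →
  T (Q (embed P Q P≤Q j p))
embed-sound P Q P≤Q j p = enum-sound Q _

embed-injective : ∀ {n} (P Q : Fin n → Bool) .(P≤Q : count P ≤ count Q) {j j'} (p : T (P j)) (p' : T (P j')) →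
  embed P Q P≤Q j p ≡ embed P Q P≤Q j' p' → j ≡ j'
embed-injective P Q P≤Q {j} {j'} p p' eq = begin
  j                      ≡⟨ enum-rank P j p ⟨
  enum P (rank P j p)    ≡⟨ cong (enum P) (toℕ-injective rank-toℕ) ⟩
  enum P (rank P j' p')  ≡⟨ enum-rank P j' p' ⟩
  j'                     ∎
  where
  open ≡-Reasoning
  rank-toℕ : toℕ (rank P j p) ≡ toℕ (rank P j' p')
  rank-toℕ = begin
    toℕ (rank P j p)                 ≡⟨ toℕ-inject≤ (rank P j p) P≤Q ⟨
    toℕ (inject≤ (rank P j p) P≤Q)   ≡⟨ cong toℕ (enum-injective Q eq) ⟩
    toℕ (inject≤ (rank P j' p') P≤Q) ≡⟨ toℕ-inject≤ (rank P j' p') P≤Q ⟩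
    toℕ (rank P j' p')               ∎

count-≟v≤maxMult : ∀ {m n} (v : Matrix m n) w → count (λ k → does (v k ≟v w)) ≤ maxMult v
count-≟v≤maxMult v w with count≡0⊎∃ (λ k → does (v k ≟v w))
... | inj₁ empty rewrite empty = z≤n
... | inj₂ (k , vk≡w) with does⇒ (v k ≟v w) vk≡w
... | refl = f≤maxF (mult v) k

-- (a , x) < (b , not x) lexicographically, with false < true.
lexBelow : ℕ → ℕ → Bool → Bool
lexBelow zero    zero    x = not x
lexBelow zero    (suc b) x = true
lexBelow (suc a) zero    x = false
lexBelow (suc a) (suc b) x = lexBelow a b x

lexBelow-total : ∀ a b x → T (lexBelow a b x ∨ lexBelow b a (not x))
lexBelow-total zero    zero    true  = _
lexBelow-total zero    zero    false = _
lexBelow-total zero    (suc b) x     = _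
lexBelow-total (suc a) zero    x     = _
lexBelow-total (suc a) (suc b) x     = lexBelow-total a b x

lexBelow-asym : ∀ a b x → T (lexBelow a b x) → ¬ T (lexBelow b a (not x))
lexBelow-asym zero    zero    false _ ()
lexBelow-asym zero    (suc b) x     _ ()
lexBelow-asym (suc a) (suc b) x     = lexBelow-asym a b x

lexBelow⇒≤ : ∀ {a b x} → T (lexBelow a b x) → a ≤ b
lexBelow⇒≤ {zero}          _  = z≤n
lexBelow⇒≤ {suc a} {suc b} lt = s≤s (lexBelow⇒≤ {a} {b} lt)

σ≤k*p⇒⌈σ/p⌉≤k : ∀ σ p k → σ ≤ k * p → ⌈ σ / p ⌉ ≤ k
σ≤k*p⇒⌈σ/p⌉≤k σ zero    k _      = z≤n
σ≤k*p⇒⌈σ/p⌉≤k σ (suc q) k σ≤k*p = s≤s⁻¹ (m<n*o⇒m/o<n (s≤s (begin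
  σ + q          ≤⟨ +-monoˡ-≤ q σ≤k*p ⟩
  k * suc q + q  ≡⟨ +-comm (k * suc q) q ⟩
  q + k * suc q  ∎)))
  where open ≤-Reasoning

module Matching {m n} (v : Matrix m n) (i : Fin n) (vᵢ≢𝟎 : v i ≢ 𝟎) where

  u : F2Vec m
  u = v i

  r : Fin m
  r = proj₁ (≢𝟎⇒∃lookup≡true vᵢ≢𝟎)

  u[r]≡true : lookup u r ≡ true
  u[r]≡true = proj₂ (≢𝟎⇒∃lookup≡true vᵢ≢𝟎)

  other : Fin n → Bool
  other j = not (does (j ≟ i))

  class : F2Vec m → Fin n → Bool
  class w k = other k ∧ does (v k ≟v w)

  -- Of the classes of w and u ⊕ w, which differ at coordinate r, exactly one is matched into the other.
  matched : F2Vec m → Bool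
  matched w = lexBelow (count (class w)) (count (class (u ⊕ w))) (lookup w r)

  covered : Fin n → Bool
  covered j = other j ∧ matched (v j)

  -- tripleCount v i is pairCount triple by definition.
  triple : Fin n → Fin n → Bool
  triple j k = other j ∧ (other k ∧ does ((u ⊕ v j ⊕ v k) ≟v 𝟎))

  matched-flip : ∀ w → matched (u ⊕ w) ≡ lexBelow (count (class (u ⊕ w))) (count (class w)) (not (lookup w r))
  matched-flip w = cong₂ (lexBelow (count (class (u ⊕ w)))) (cong (count ∘ class) (x⊕[x⊕y]≡y u w)) u⊕w[r]
    where
    u⊕w[r] : lookup (u ⊕ w) r ≡ not (lookup w r)
    u⊕w[r] = trans (lookup-zipWith _xor_ r u w) (cong (_xor lookup w r) u[r]≡true)

  matched-either : ∀ w → T (matched w ∨ matched (u ⊕ w))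
  matched-either w rewrite matched-flip w =
    lexBelow-total (count (class w)) (count (class (u ⊕ w))) (lookup w r)

  matched-unique : ∀ w → T (matched w) → ¬ T (matched (u ⊕ w))
  matched-unique w mw rewrite matched-flip w =
    lexBelow-asym (count (class w)) (count (class (u ⊕ w))) (lookup w r) mw

  triple⇒ : ∀ {j k} → T (triple j k) → T (other j) × T (other k) × v k ≡ u ⊕ v j
  triple⇒ {j} {k} t =
    let oj , t′ = to T-∧ t
        ok , z  = to T-∧ t′
    in oj , ok , sym (x⊕y≡𝟎⇒x≡y (does⇒ ((u ⊕ v j ⊕ v k) ≟v 𝟎) z))

  triple-sym : ∀ j k → triple j k ≡ triple k j
  triple-sym j k rewrite x⊕y⊕z≡x⊕z⊕y u (v j) (v k) = begin
    a ∧ (b ∧ c)   ≡⟨ ∧-assoc a b c ⟨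
    (a ∧ b) ∧ c   ≡⟨ cong (_∧ c) (∧-comm a b) ⟩
    (b ∧ a) ∧ c   ≡⟨ ∧-assoc b a c ⟩
    b ∧ (a ∧ c)   ∎
    where
    open ≡-Reasoning
    a b c : Bool
    a = other j
    b = other k
    c = does ((u ⊕ v k ⊕ v j) ≟v 𝟎)

  triple-covered : ∀ j k → T (triple j k) → T (covered j ∨ covered k)
  triple-covered j k t with triple⇒ t
  ... | oj , ok , vk≡u⊕vj = from T-∨ (Sum.map (λ mj → from T-∧ (oj , mj))
                                              (λ mk → from T-∧ (ok , subst (T ∘ matched) (sym vk≡u⊕vj) mk))
                                              (to T-∨ (matched-either (v j))))

  triple-degree : ∀ j → count (triple j) ≤ maxMult v
  triple-degree j = ≤-trans
    (count-mono {P = triple j} (λ k t → ⇒does (v k ≟v (u ⊕ v j)) (proj₂ (proj₂ (triple⇒ t)))))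
    (count-≟v≤maxMult v (u ⊕ v j))

  tripleCount≤covered*maxMult : tripleCount v i ≤ count covered * maxMult v
  tripleCount≤covered*maxMult =
    pairCount≤count*degree triple covered (maxMult v) triple-sym triple-covered (λ j _ → triple-degree j)

  covered⇒other : ∀ {j} → T (covered j) → T (other j)
  covered⇒other = proj₁ ∘ to T-∧

  covered⇒matched : ∀ {j} → T (covered j) → T (matched (v j))
  covered⇒matched = proj₂ ∘ to T-∧

  covered⇒∈class : ∀ {j} → T (covered j) → T (class (v j) j)
  covered⇒∈class {j} c = from T-∧ (covered⇒other c , ⇒does (v j ≟v v j) refl)

  partner : ∀ j → T (covered j) → Fin n
  partner j c =
    embed (class (v j)) (class (u ⊕ v j)) (lexBelow⇒≤ (covered⇒matched c)) j (covered⇒∈class c)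

  partner∈class : ∀ {j} (c : T (covered j)) → T (class (u ⊕ v j) (partner j c))
  partner∈class {j} c = embed-sound (class (v j)) (class (u ⊕ v j)) _ j (covered⇒∈class c)

  partner-other : ∀ {j} (c : T (covered j)) → T (other (partner j c))
  partner-other c = proj₁ (to T-∧ (partner∈class c))

  partner-value : ∀ {j} (c : T (covered j)) → v (partner j c) ≡ u ⊕ v j
  partner-value {j} c = does⇒ (v (partner j c) ≟v (u ⊕ v j)) (proj₂ (to T-∧ (partner∈class c)))

  partner-uncovered : ∀ {j} (c : T (covered j)) → ¬ T (covered (partner j c))
  partner-uncovered {j} c c-partner = matched-unique (v j) (covered⇒matched c)
    (subst (T ∘ matched) (partner-value c) (covered⇒matched c-partner))

  partner-injective : ∀ {j j'} (c : T (covered j)) (c' : T (covered j')) → partner j c ≡ partner j' c' → j ≡ j'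
  partner-injective {j} {j'} c c' eq = embed-class-injective vj≡vj' _ _ _ _ eq
    where
    vj≡vj' : v j ≡ v j'
    vj≡vj' = ⊕-cancelˡ-≡ u (trans (sym (partner-value c)) (trans (cong v eq) (partner-value c')))

    embed-class-injective : ∀ {w w'} → w ≡ w' →
      .(w≤ : count (class w) ≤ count (class (u ⊕ w))) .(w'≤ : count (class w') ≤ count (class (u ⊕ w')))
      (p : T (class w j)) (p' : T (class w' j')) →
      embed (class w) (class (u ⊕ w)) w≤ j p ≡ embed (class w') (class (u ⊕ w')) w'≤ j' p' → j ≡ j'
    embed-class-injective {w} refl w≤ _ = embed-injective (class w) (class (u ⊕ w)) w≤

  column : Fin (count covered) → Fin n
  column = enum covered

  column-covered : ∀ a → T (covered (column a))
  column-covered = enum-sound covered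

  pair : Fin (count covered) → Fin n × Fin n
  pair a = column a , partner (column a) (column-covered a)

  pair-valid : ∀ a → proj₁ (pair a) ≢ proj₂ (pair a) × proj₁ (pair a) ≢ i × proj₂ (pair a) ≢ i
                   × v i ≡ v (proj₁ (pair a)) ⊕ v (proj₂ (pair a))
  pair-valid a =
      (λ eq → partner-uncovered c (subst (T ∘ covered) eq c))
    , not-does⇒¬ (column a ≟ i) (covered⇒other c)
    , not-does⇒¬ (proj₂ (pair a) ≟ i) (partner-other c)
    , trans (x≡y⊕[x⊕y] u (v (column a))) (cong (v (column a) ⊕_) (sym (partner-value c)))
    where
    c = column-covered a

  pair-disjoint : ∀ a b → a ≢ b → Disjoint₂ (pair a) (pair b)
  pair-disjoint a b a≢b =
      a≢b ∘ enum-injective covered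
    , (λ eq → partner-uncovered (column-covered b) (subst (T ∘ covered) eq (column-covered a)))
    , (λ eq → partner-uncovered (column-covered a) (subst (T ∘ covered) (sym eq) (column-covered b)))
    , a≢b ∘ enum-injective covered ∘ partner-injective (column-covered a) (column-covered b)

lemma4p1 : (m n : ℕ) (v : Matrix m n) (σ : ℕ) →
    0 < σ → maxMult v < σ →
    (∀ i → σ ≤ tripleCount v i) →
    ∀ i → v i ≢ 𝟎 →
    Σ ℕ λ k → ⌈ σ / maxMult v ⌉ ≤ k ×
      Σ (Fin k → Fin n × Fin n) λ P →
        (∀ a → proj₁ (P a) ≢ proj₂ (P a) × proj₁ (P a) ≢ i × proj₂ (P a) ≢ i
               × v i ≡ v (proj₁ (P a)) ⊕ v (proj₂ (P a)))
        × (∀ a b → a ≢ b → Disjoint₂ (P a) (P b))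
lemma4p1 m n v σ _ _ σ≤tripleCount i vᵢ≢𝟎 =
    count covered
  , σ≤k*p⇒⌈σ/p⌉≤k σ (maxMult v) (count covered) (≤-trans (σ≤tripleCount i) tripleCount≤covered*maxMult)
  , pair , pair-valid , pair-disjoint
  where open Matching v i vᵢ≢𝟎
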